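{- Let $d\ge1$ and let $A\in\operatorname{Mat}_d(\mathbb{Z})$ be a nonsingular integer matrix of infinite order (i.e. $A^r\neq I$ for all $r\ge1$). Then the following are equivalent: (1) for every $\epsilon>0$, $\gcd(A^n-I)<\exp(\epsilon n)$ for all sufficiently large integers $n$; (2) $\operatorname{ord}(A,N)/\log N\to\infty$ as $N\to\infty$ (with $N$ ranging over positive integers).
   Context: $I$ is the $d\times d$ identity matrix; $\gcd(A^n-I)$ denotes the greatest common divisor of all the entries of $A^n-I$. For an integer $N\ge1$, $\operatorname{ord}(A,N)$ is the least integer $k\ge1$ with $A^k\equiv I\pmod N$ entrywise; if $A$ is not invertible modulo $N$, one sets $\operatorname{ord}(A,N)=\infty$. -}

module Defs where

open import Data.Nat as ℕ using (ℕ; zero; suc; _≤_; _<_)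
import Data.Nat.GCD as G
open import Data.Fin using (Fin; zero; suc; punchIn)
open import Data.Integer as ℤ using (ℤ; +_; ∣_∣)
open import Data.Integer.Divisibility using () renaming (_∣_ to _∣ℤ_)
open import Data.Product using (Σ; _×_; ∃)
open import Relation.Nullary using (¬_)
open import Relation.Binary.PropositionalEquality using (_≡_)

Mat : ℕ → Set
Mat d = Fin d → Fin d → ℤ

sumFin : (n : ℕ) → (Fin n → ℤ) → ℤ
sumFin zero    f = + 0
sumFin (suc n) f = f zero ℤ.+ sumFin n (λ i → f (suc i))

gcdFin : (n : ℕ) → (Fin n → ℕ) → ℕ
gcdFin zero    f = 0
gcdFin (suc n) f = G.gcd (f zero) (gcdFin n (λ i → f (suc i)))

identity : (d : ℕ) → Mat d
identity d i j with i Data.Fin.≟ j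
... | Relation.Nullary.yes _ = + 1
... | Relation.Nullary.no  _ = + 0
  where import Data.Fin

_⊗_ : ∀ {d} → Mat d → Mat d → Mat d
_⊗_ {d} A B i j = sumFin d (λ k → A i k ℤ.* B k j)

_⊖_ : ∀ {d} → Mat d → Mat d → Mat d
(A ⊖ B) i j = A i j ℤ.- B i j

pow : ∀ {d} → Mat d → ℕ → Mat d
pow {d} A zero    = identity d
pow {d} A (suc n) = A ⊗ pow A n

det : (d : ℕ) → Mat d → ℤ
det zero    A = + 1
det (suc n) A = sumFin (suc n) (λ j → sgn j ℤ.* (A zero j ℤ.* det n (minor j)))
  where
  sgn : Fin (suc n) → ℤ
  sgn j with Data.Nat.DivMod._%_ (Data.Fin.toℕ j) 2
    where import Data.Nat.DivMod; import Data.Fin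
  ... | zero = + 1
  ... | suc _ = ℤ.- (+ 1)
  minor : Fin (suc n) → Mat n
  minor j r c = A (suc r) (punchIn j c)

gcdMat : ∀ {d} → Mat d → ℕ
gcdMat {d} M = gcdFin d (λ i → gcdFin d (λ j → ∣ M i j ∣))

CongMod : ∀ {d} → ℕ → Mat d → Mat d → Set
CongMod N A B = ∀ i j → (+ N) ∣ℤ (A i j ℤ.- B i j)

-- ord(A,N) = k  (k finite): k ≥ 1 least with A^k ≡ I (mod N).
-- ord(A,N) = ∞ corresponds to there being no such k.
OrdIs : ∀ {d} → Mat d → ℕ → ℕ → Set
OrdIs {d} A N k =
  (1 ≤ k) × CongMod N (pow A k) (identity d) ×
  (∀ j → 1 ≤ j → j < k → ¬ CongMod N (pow A j) (identity d))

-- Exponential, exactly via partial sums of its series, in ℕ: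
-- expPartial m t = m! * Σ_{j=0}^{m} t^j / j!   (an integer).
expPartial : ℕ → ℕ → ℕ
expPartial zero    t = 1
expPartial (suc m) t = suc m ℕ.* expPartial m t ℕ.+ t ℕ.^ suc m

-- LtExp x t  ⇔  (x : ℝ) < exp(t)  for naturals x t
-- (the partial sums increase strictly-to exp t, so x < exp t iff some
-- partial sum exceeds x).
LtExp : ℕ → ℕ → Set
LtExp x t = ∃ λ m → x ℕ.* (m ℕ.!) < expPartial m t

-- Condition (1): for every ε = p/q > 0, gcd(A^n - I) < exp(ε n) eventually,
-- written as gcd(A^n - I)^q < exp(p n).
Cond1 : ∀ {d} → Mat d → Set
Cond1 {d} A = ∀ p q → 1 ≤ p → 1 ≤ q →
  ∃ λ n₀ → ∀ n → n₀ ≤ n →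
    LtExp (gcdMat (pow A n ⊖ identity d) ℕ.^ q) (p ℕ.* n)

-- Condition (2): ord(A,N)/log N → ∞: for every bound M = p/q > 0,
-- eventually ord(A,N) > (p/q) log N, i.e. N^p < exp(q · ord(A,N));
-- automatically true when ord(A,N) = ∞.
Cond2 : ∀ {d} → Mat d → Set
Cond2 {d} A = ∀ p q → 1 ≤ p → 1 ≤ q →
  ∃ λ N₀ → ∀ N → N₀ ≤ N → 1 ≤ N →
    ∀ k → OrdIs A N k → LtExp (N ℕ.^ p) (q ℕ.* k)

{-# OPTIONS --safe #-}
-- Write g(n) = gcd(Aⁿ − I). Since A has infinite order, g(n) ≠ 0 for n ≥ 1, and
-- N ∣ g(n) exactly when Aⁿ ≡ I (mod N). Hence N ≤ g(ord(A,N)), and ord(A, g(n)) ≤ n.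
-- (1) ⇒ (2): once N exceeds the finitely many values g(r), r < n₀, the order
-- k = ord(A,N) is at least n₀, so N^p ≤ g(k)^p < exp(qk).
-- (2) ⇒ (1): if g(n) is large then g(n)^q < exp(p · ord(A, g(n))) ≤ exp(pn);
-- if g(n) is bounded then g(n)^q is eventually below pn < exp(pn).
module Submission where

open import Defs
open import Data.Nat using (ℕ; _≤_)
open import Data.Integer using (+_)
open import Data.Product using (_×_)
open import Relation.Nullary using (¬_)
open import Relation.Binary.PropositionalEquality using (_≡_)
open import Function.Bundles using (_⇔_)

open import Data.Nat using (zero; suc; _<_; _^_; _*_; _⊔_; _!; s≤s; z≤n; ≢-nonZero; >-nonZero)
open import Data.Nat.Properties
open import Data.Nat.Induction using (<-rec)
open import Data.Nat.Divisibility using (_∣_; _∣?_; _∣0; ∣-trans; ∣⇒≤; 0∣⇒≡0)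
open import Data.Nat.GCD using (gcd[m,n]∣m; gcd[m,n]∣n; gcd-greatest)
open import Data.Fin using (Fin; zero; suc)
open import Data.Fin.Properties using (all?)
open import Data.Integer using (∣_∣; _-_)
open import Data.Integer.Properties using (i-j≡0⇒i≡j; ∣i∣≡0⇒i≡0)
open import Data.Product using (∃; _,_)
open import Data.Sum using (inj₁; inj₂)
open import Relation.Nullary using (Dec; yes; no)
open import Relation.Unary using (Pred; Decidable)
open import Relation.Binary.PropositionalEquality using (refl; sym; subst; subst₂)
open import Function.Bundles using (mk⇔)

expPartial-monoʳ-≤ : ∀ m {t t′} → t ≤ t′ → expPartial m t ≤ expPartial m t′
expPartial-monoʳ-≤ zero    t≤t′ = ≤-refl
expPartial-monoʳ-≤ (suc m) t≤t′ =
  +-mono-≤ (*-monoʳ-≤ (suc m) (expPartial-monoʳ-≤ m t≤t′)) (^-monoˡ-≤ (suc m) t≤t′)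

LtExp-≤-trans : ∀ {x t t′} → LtExp x t → t ≤ t′ → LtExp x t′
LtExp-≤-trans (m , x<e) t≤t′ = m , <-≤-trans x<e (expPartial-monoʳ-≤ m t≤t′)

≤-LtExp-trans : ∀ {x′ x t} → x′ ≤ x → LtExp x t → LtExp x′ t
≤-LtExp-trans x′≤x (m , x<e) = m , ≤-<-trans (*-monoˡ-≤ (m !) x′≤x) x<e

≤⇒LtExp : ∀ {x t} → x ≤ t → LtExp x t
≤⇒LtExp {x} {t} x≤t = 1 , s≤s (subst₂ _≤_ (sym (*-identityʳ x)) (sym (*-identityʳ t)) x≤t)

gcdFin-∣ : ∀ n (f : Fin n → ℕ) i → gcdFin n f ∣ f i
gcdFin-∣ (suc n) f zero    = gcd[m,n]∣m _ _
gcdFin-∣ (suc n) f (suc i) = ∣-trans (gcd[m,n]∣n (f zero) _) (gcdFin-∣ n (λ i → f (suc i)) i)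

gcdFin-greatest : ∀ n (f : Fin n → ℕ) {c} → (∀ i → c ∣ f i) → c ∣ gcdFin n f
gcdFin-greatest zero    f {c} _ = c ∣0
gcdFin-greatest (suc n) f c∣f =
  gcd-greatest (c∣f zero) (gcdFin-greatest n (λ i → f (suc i)) (λ i → c∣f (suc i)))

-- Entrywise, CongMod N B C unfolds to N ∣ ∣ (B ⊖ C) i j ∣ in ℕ.
gcdMat-congMod : ∀ {d} (B C : Mat d) → CongMod (gcdMat (B ⊖ C)) B C
gcdMat-congMod {d} B C i j = ∣-trans (gcdFin-∣ d _ i) (gcdFin-∣ d _ j)

congMod⇒∣gcdMat : ∀ {d N} {B C : Mat d} → CongMod N B C → N ∣ gcdMat (B ⊖ C)
congMod⇒∣gcdMat {d} B≡C = gcdFin-greatest d _ (λ i → gcdFin-greatest d _ (B≡C i))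

gcdMat-⊖≡0⇒≡ : ∀ {d} (B C : Mat d) → gcdMat (B ⊖ C) ≡ 0 → ∀ i j → B i j ≡ C i j
gcdMat-⊖≡0⇒≡ B C gcd≡0 i j =
  i-j≡0⇒i≡j _ _ (∣i∣≡0⇒i≡0 (0∣⇒≡0 (subst (_∣ _) gcd≡0 (gcdMat-congMod B C i j))))

congMod? : ∀ {d} N (B C : Mat d) → Dec (CongMod N B C)
congMod? N B C = all? (λ i → all? (λ j → N ∣? ∣ B i j - C i j ∣))

module _ {p} {P : Pred ℕ p} (P? : Decidable P) where

  LeastUpTo : ℕ → Set p
  LeastUpTo n = ∃ λ k → k ≤ n × P k × (∀ {j} → j < k → ¬ P j)

  least : ∀ n → P n → LeastUpTo n
  least = <-rec (λ n → P n → LeastUpTo n) search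
    where
    search : ∀ n → (∀ {m} → m < n → P m → LeastUpTo m) → P n → LeastUpTo n
    search n below Pn with anyUpTo? P? n
    ... | no ∄ = n , ≤-refl , Pn , λ j<n Pj → ∄ (_ , j<n , Pj)
    ... | yes (m , m<n , Pm) with below m<n Pm
    ...   | k , k≤m , Pk , minimal = k , ≤-trans k≤m (<⇒≤ m<n) , Pk , minimal

boundedUpTo : (g : ℕ → ℕ) (n : ℕ) → ∃ λ B → ∀ {r} → r < n → g r < B
boundedUpTo g zero = 0 , λ ()
boundedUpTo g (suc n) with boundedUpTo g n
... | B , bound = suc (g n) ⊔ B , below
  where
  below : ∀ {r} → r < suc n → g r < suc (g n) ⊔ B
  below (s≤s r≤n) with m≤n⇒m<n∨m≡n r≤n
  ... | inj₁ r<n  = <-≤-trans (bound r<n) (m≤n⊔m (suc (g n)) B)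
  ... | inj₂ refl = m≤m⊔n (suc (g n)) B

InfiniteOrder : ∀ {d} → Mat d → Set
InfiniteOrder {d} A = ∀ r → 1 ≤ r → ¬ (∀ i j → pow A r i j ≡ identity d i j)

gcdPow⊖I : ∀ {d} → Mat d → ℕ → ℕ
gcdPow⊖I {d} A n = gcdMat (pow A n ⊖ identity d)

OrdIs-exists : ∀ {d} (A : Mat d) {N n} → 1 ≤ n → CongMod N (pow A n) (identity d) →
               ∃ λ k → k ≤ n × OrdIs A N k
OrdIs-exists {d} A {N} {suc n} _ Aⁿ≡I
  with least (λ k → congMod? N (pow A (suc k)) (identity d)) n Aⁿ≡I
... | k , k≤n , Aᵏ≡I , minimal = suc k , s≤s k≤n , s≤s z≤n , Aᵏ≡I , earlier
  where
  earlier : ∀ j → 1 ≤ j → j < suc k → ¬ CongMod N (pow A j) (identity d)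
  earlier (suc j) _ (s≤s j<k) = minimal j<k

OrdIs⇒≤gcdPow⊖I : ∀ {d} (A : Mat d) {N k} → InfiniteOrder A → OrdIs A N k → N ≤ gcdPow⊖I A k
OrdIs⇒≤gcdPow⊖I {d} A {k = k} infinite (k≥1 , Aᵏ≡I , _) =
  ∣⇒≤ {{≢-nonZero (λ gcd≡0 → infinite k k≥1 (gcdMat-⊖≡0⇒≡ _ _ gcd≡0))}}
      (congMod⇒∣gcdMat {B = pow A k} {identity d} Aᵏ≡I)

Cond1⇒Cond2 : ∀ {d} (A : Mat d) → InfiniteOrder A → Cond1 A → Cond2 A
Cond1⇒Cond2 A infinite cond1 p q p≥1 q≥1 with cond1 q p q≥1 p≥1
... | n₀ , small with boundedUpTo (gcdPow⊖I A) n₀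
... | B , bound = B , large
  where
  large : ∀ N → B ≤ N → 1 ≤ N → ∀ k → OrdIs A N k → LtExp (N ^ p) (q * k)
  large N B≤N _ k ord = ≤-LtExp-trans (^-monoˡ-≤ p N≤g) (small k n₀≤k)
    where
    N≤g : N ≤ gcdPow⊖I A k
    N≤g = OrdIs⇒≤gcdPow⊖I A infinite ord
    n₀≤k : n₀ ≤ k
    n₀≤k = ≮⇒≥ (λ k<n₀ → <⇒≱ (bound k<n₀) (≤-trans B≤N N≤g))

Cond2⇒Cond1 : ∀ {d} (A : Mat d) → Cond2 A → Cond1 A
Cond2⇒Cond1 A cond2 p q p≥1 q≥1 with cond2 q p q≥1 p≥1
... | N₀ , large = suc (N₀ ^ q) , small
  where
  small : ∀ n → suc (N₀ ^ q) ≤ n → LtExp (gcdPow⊖I A n ^ q) (p * n)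
  small n n₀≤n with gcdPow⊖I A n ≤? N₀
  ... | yes g≤N₀ = ≤⇒LtExp (begin
    gcdPow⊖I A n ^ q ≤⟨ ^-monoˡ-≤ q g≤N₀ ⟩
    N₀ ^ q           ≤⟨ n≤1+n _ ⟩
    suc (N₀ ^ q)     ≤⟨ n₀≤n ⟩
    n                ≤⟨ m≤n*m n p {{>-nonZero p≥1}} ⟩
    p * n            ∎)
    where open ≤-Reasoning
  ... | no g≰N₀ with OrdIs-exists A (≤-trans (s≤s z≤n) n₀≤n) (gcdMat-congMod (pow A n) _)
  ...   | k , k≤n , ord =
    LtExp-≤-trans {gcdPow⊖I A n ^ q}
      (large (gcdPow⊖I A n) (<⇒≤ N₀<g) (≤-trans (s≤s z≤n) N₀<g) k ord) (*-monoʳ-≤ p k≤n)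
    where
    N₀<g : N₀ < gcdPow⊖I A n
    N₀<g = ≰⇒> g≰N₀

mainTheorem3 : (d : ℕ) → 1 ≤ d → (A : Mat d) →
    ¬ (det d A ≡ + 0) →
    (∀ r → 1 ≤ r → ¬ (∀ i j → pow A r i j ≡ identity d i j)) →
    Cond1 A ⇔ Cond2 A
mainTheorem3 d _ A _ infinite = mk⇔ (Cond1⇒Cond2 A infinite) (Cond2⇒Cond1 A)
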